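{- For every integer $n\ge0$, $$c_{n,2}(1)=c_{n,2}(2)=\binom{n}{\lfloor n/2\rfloor}.$$
   Context: For a word $u$ over the positive integers, $c_{n,m}(u)$ is the number of words $w\in\{1,\ldots,m\}^n$ such that $uw\equiv wu$, where $\equiv$ is Knuth equivalence (equivalently, $P(uw)=P(wu)$ for RSK insertion tableaux). Here $u=1$ or $u=2$ is a one-letter word. -}

module Defs where

open import Data.Nat using (ℕ; zero; suc; _≤_; _<_)
open import Data.List using (List; []; _∷_; _++_; length)
open import Data.List.Relation.Unary.All using (All)
open import Data.List.Relation.Unary.Unique.Propositional using (Unique)
open import Data.List.Membership.Propositional using (_∈_)
open import Data.Product using (Σ; _×_; _,_)
open import Function.Bundles using (_⇔_)
open import Relation.Binary.PropositionalEquality using (_≡_)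

-- Words over the positive integers are lists of natural numbers
-- (letters are required to be ≥ 1 where relevant).
Word : Set
Word = List ℕ

data KnuthStep : Word → Word → Set where
  knuth1 : ∀ {x y z} → x < y → y ≤ z → KnuthStep (y ∷ z ∷ x ∷ []) (y ∷ x ∷ z ∷ [])
  knuth2 : ∀ {x y z} → x ≤ y → y < z → KnuthStep (x ∷ z ∷ y ∷ []) (z ∷ x ∷ y ∷ [])

data _≡K_ : Word → Word → Set where
  step  : ∀ p s {a b} → KnuthStep a b → (p ++ a ++ s) ≡K (p ++ b ++ s)
  K-refl  : ∀ {w} → w ≡K w
  K-sym   : ∀ {v w} → v ≡K w → w ≡K v
  K-trans : ∀ {u v w} → u ≡K v → v ≡K w → u ≡K w

InAlphabet : ℕ → ℕ → Word → Set
InAlphabet n m w = (length w ≡ n) × All (λ a → 1 ≤ a × a ≤ m) w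

Commutes : Word → Word → Set
Commutes u w = (u ++ w) ≡K (w ++ u)

c-is : ℕ → ℕ → Word → ℕ → Set
c-is n m u k =
  Σ (List Word) λ L →
    Unique L × (∀ w → (w ∈ L) ⇔ (InAlphabet n m w × Commutes u w)) × length L ≡ k

{-# OPTIONS --safe #-}
module Submission where

-- Over the alphabet {1,2} a Knuth class is determined by its insertion tableau, whose first
-- row is 1ᵃ2ᵇ and second row 2ᶜ.  A leading 1 is never bumped, so P(1w) is P(w) with one
-- more 1, whereas appending a 1 bumps a 2 out of the first row whenever there is one; hence
-- 1w ≡ w1 iff the first row of P(w) contains no 2.  While w is read, the number of 2s in the
-- first row performs a walk that goes up on 2 and down on 1 (staying at 0 at the floor), and
-- the walks of length n from height k that end at 0 number C(n, ⌈(k+n)/2⌉) by Pascal's rule.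
-- For u = 2, reversing a word and exchanging 1 ↔ 2 preserves Knuth equivalence and turns
-- words commuting with 2 into words commuting with 1.

open import Defs
open import Data.Nat using (ℕ; zero; suc; _+_; _∸_; _/_; ⌊_/2⌋; ⌈_/2⌉; _≤_; _<_; z≤n; s≤s)
open import Data.Nat.Properties using (≤-refl; +-suc; m+n∸n≡m; ⌊n/2⌋+⌈n/2⌉≡n; ⌈n/2⌉≤n)
open import Data.Nat.DivMod using (m/n≡1+[m∸n]/n)
open import Data.Nat.Combinatorics using (_C_; nCk≡nC[n∸k]; nCk+nC[k+1]≡[n+1]C[k+1])
open import Data.List using (List; []; _∷_; _++_; _∷ʳ_; length; map; reverse; replicate)
open import Data.List.Properties
  using (++-assoc; ++-identityʳ; length-++; length-map; length-reverse; map-++; reverse-++;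
         reverse-involutive; reverse-map; map-∘; map-cong; map-id; ∷-injectiveʳ)
open import Data.List.Relation.Unary.All as All using (All; []; _∷_)
import Data.List.Relation.Unary.All.Properties as All
open import Data.List.Relation.Unary.Unique.Propositional using (Unique)
import Data.List.Relation.Unary.Unique.Propositional.Properties as Unique
import Data.List.Relation.Unary.AllPairs as AllPairs
open import Data.List.Relation.Binary.Permutation.Propositional using (_↭_; prep; swap; ↭-refl; ↭-sym; ↭-trans)
open import Data.List.Relation.Binary.Permutation.Propositional.Properties using (All-resp-↭; ++⁺ˡ; ++⁺ʳ; ↭-reverse)
open import Data.List.Membership.Propositional using (_∈_)
open import Data.List.Membership.Propositional.Properties using (∈-map⁺; ∈-map⁻; ∈-++⁺ˡ; ∈-++⁺ʳ; ∈-++⁻)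
open import Data.List.Relation.Unary.Any using (here)
open import Data.Product using (_×_; _,_; proj₂)
open import Data.Sum using (inj₁; inj₂)
open import Data.Empty using (⊥)
open import Function.Base using (id)
open import Function.Bundles using (_⇔_; mk⇔; Equivalence)
open import Function.Properties.Equivalence using (⇔-setoid)
open import Level using (0ℓ)
open import Relation.Binary.Bundles using (Setoid)
import Relation.Binary.Reasoning.Setoid as SetoidReasoning
open import Relation.Binary.PropositionalEquality using (_≡_; refl; sym; trans; cong; subst; subst₂; cong₂; module ≡-Reasoning)

≡K-setoid : Setoid 0ℓ 0ℓ
≡K-setoid = record
  { Carrier       = Word
  ; _≈_           = _≡K_
  ; isEquivalence = record { refl = K-refl ; sym = K-sym ; trans = K-trans }
  }

module ≡K-Reasoning = SetoidReasoning ≡K-setoid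
open Setoid ≡K-setoid using () renaming (reflexive to ≡⇒≡K)

≡K-cong : ∀ p s {u v} → u ≡K v → (p ++ u ++ s) ≡K (p ++ v ++ s)
≡K-cong p s (step p′ s′ {a} {b} k) = subst₂ _≡K_ (reassoc a) (reassoc b) (step (p ++ p′) (s′ ++ s) k)
  where
  reassoc : ∀ x → (p ++ p′) ++ x ++ s′ ++ s ≡ p ++ (p′ ++ x ++ s′) ++ s
  reassoc x = begin
    (p ++ p′) ++ x ++ s′ ++ s   ≡⟨ ++-assoc p p′ _ ⟩
    p ++ p′ ++ x ++ s′ ++ s     ≡⟨ cong (λ y → p ++ p′ ++ y) (++-assoc x s′ s) ⟨
    p ++ p′ ++ (x ++ s′) ++ s   ≡⟨ cong (p ++_) (++-assoc p′ (x ++ s′) s) ⟨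
    p ++ (p′ ++ x ++ s′) ++ s   ∎
    where open ≡-Reasoning
≡K-cong p s K-refl        = K-refl
≡K-cong p s (K-sym e)     = K-sym (≡K-cong p s e)
≡K-cong p s (K-trans e f) = K-trans (≡K-cong p s e) (≡K-cong p s f)

≡K-++ʳ : ∀ s {u v} → u ≡K v → (u ++ s) ≡K (v ++ s)
≡K-++ʳ = ≡K-cong []

≡K-++ˡ : ∀ p {u v} → u ≡K v → (p ++ u) ≡K (p ++ v)
≡K-++ˡ p {u} {v} e = subst₂ (λ x y → (p ++ x) ≡K (p ++ y)) (++-identityʳ u) (++-identityʳ v) (≡K-cong p [] e)

knuthStep⇒≡K : ∀ {u v} → KnuthStep u v → u ≡K v
knuthStep⇒≡K {u} {v} k = subst₂ _≡K_ (++-identityʳ u) (++-identityʳ v) (step [] [] k)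

knuthStep⇒↭ : ∀ {u v} → KnuthStep u v → u ↭ v
knuthStep⇒↭ (knuth1 {x} {y} {z} _ _) = prep y (swap z x ↭-refl)
knuthStep⇒↭ (knuth2 {x} {y} {z} _ _) = swap x z ↭-refl

≡K⇒↭ : ∀ {u v} → u ≡K v → u ↭ v
≡K⇒↭ (step p s k)  = ++⁺ˡ p (++⁺ʳ s (knuthStep⇒↭ k))
≡K⇒↭ K-refl        = ↭-refl
≡K⇒↭ (K-sym e)     = ↭-sym (≡K⇒↭ e)
≡K⇒↭ (K-trans e f) = ↭-trans (≡K⇒↭ e) (≡K⇒↭ f)

All-resp-≡K : ∀ {P : ℕ → Set} {u v} → u ≡K v → All P u → All P v
All-resp-≡K e = All-resp-↭ (≡K⇒↭ e)

All-++-middle : ∀ {P : ℕ → Set} p {u s} → All P (p ++ u ++ s) → All P u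
All-++-middle p {u} all = All.++⁻ˡ u (All.++⁻ʳ p all)

data Letter : ℕ → Set where
  one : Letter 1
  two : Letter 2

letter : ∀ {a} → 1 ≤ a × a ≤ 2 → Letter a
letter {1} _ = one
letter {2} _ = two
letter {suc (suc (suc _))} (_ , s≤s (s≤s ()))

letter-bounds : ∀ {a} → Letter a → 1 ≤ a × a ≤ 2
letter-bounds one = s≤s z≤n , s≤s z≤n
letter-bounds two = s≤s z≤n , s≤s (s≤s z≤n)

inAlphabet₂⇔ : ∀ {n w} → InAlphabet n 2 w ⇔ (length w ≡ n × All Letter w)
inAlphabet₂⇔ = mk⇔ (λ (l , bs) → l , All.map letter bs) (λ (l , ls) → l , All.map letter-bounds ls)

data KnuthStep₁₂ : Word → Word → Set where
  221~212 : KnuthStep₁₂ (2 ∷ 2 ∷ 1 ∷ []) (2 ∷ 1 ∷ 2 ∷ [])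
  121~211 : KnuthStep₁₂ (1 ∷ 2 ∷ 1 ∷ []) (2 ∷ 1 ∷ 1 ∷ [])

knuthStep₁₂ : ∀ {u v} → KnuthStep u v → All Letter u → KnuthStep₁₂ u v
knuthStep₁₂ (knuth1 _ _) (two ∷ two ∷ one ∷ []) = 221~212
knuthStep₁₂ (knuth1 (s≤s ()) _) (one ∷ _ ∷ one ∷ [])
knuthStep₁₂ (knuth1 _ (s≤s ())) (two ∷ one ∷ one ∷ [])
knuthStep₁₂ (knuth1 (s≤s ()) _) (one ∷ _ ∷ two ∷ [])
knuthStep₁₂ (knuth1 (s≤s (s≤s ())) _) (two ∷ _ ∷ two ∷ [])
knuthStep₁₂ (knuth2 _ _) (one ∷ two ∷ one ∷ []) = 121~211
knuthStep₁₂ (knuth2 _ (s≤s ())) (_ ∷ one ∷ two ∷ [])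
knuthStep₁₂ (knuth2 _ (s≤s (s≤s ()))) (_ ∷ two ∷ two ∷ [])
knuthStep₁₂ (knuth2 _ (s≤s ())) (_ ∷ one ∷ one ∷ [])
knuthStep₁₂ (knuth2 (s≤s ()) _) (two ∷ two ∷ one ∷ [])

-- tab a b c is the tableau with first row 1ᵃ2ᵇ and second row 2ᶜ.
record Tableau : Set where
  constructor tab
  field
    ones₁ twos₁ twos₂ : ℕ

open Tableau

∅ : Tableau
∅ = tab 0 0 0

-- Any letter other than 1 is inserted as if it were 2.
insert : ℕ → Tableau → Tableau
insert 1 (tab a zero    c) = tab (suc a) zero c
insert 1 (tab a (suc b) c) = tab (suc a) b (suc c)
insert _ (tab a b       c) = tab a (suc b) c

insertAll : Word → Tableau → Tableau
insertAll []      t = t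
insertAll (x ∷ w) t = insertAll w (insert x t)

P : Word → Tableau
P w = insertAll w ∅

1^ 2^ : ℕ → Word
1^ k = replicate k 1
2^ k = replicate k 2

readingWord : Tableau → Word
readingWord (tab a b c) = 2^ c ++ 1^ a ++ 2^ b

insertAll-++ : ∀ u v t → insertAll (u ++ v) t ≡ insertAll v (insertAll u t)
insertAll-++ []      v t = refl
insertAll-++ (x ∷ u) v t = insertAll-++ u v (insert x t)

insertAll-respects-knuthStep₁₂ : ∀ {u v} → KnuthStep₁₂ u v → ∀ t → insertAll u t ≡ insertAll v t
insertAll-respects-knuthStep₁₂ 221~212 t                 = refl
insertAll-respects-knuthStep₁₂ 121~211 (tab a zero c)    = refl
insertAll-respects-knuthStep₁₂ 121~211 (tab a (suc b) c) = refl

insertAll-respects-≡K : ∀ {u v} → u ≡K v → All Letter u → ∀ t → insertAll u t ≡ insertAll v t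
insertAll-respects-≡K (step p s {a} {b} k) letters t = begin
  insertAll (p ++ a ++ s) t                    ≡⟨ insertAll-++ p (a ++ s) t ⟩
  insertAll (a ++ s) (insertAll p t)           ≡⟨ insertAll-++ a s _ ⟩
  insertAll s (insertAll a (insertAll p t))    ≡⟨ cong (insertAll s) (insertAll-respects-knuthStep₁₂ (knuthStep₁₂ k (All-++-middle p letters)) _) ⟩
  insertAll s (insertAll b (insertAll p t))    ≡⟨ insertAll-++ b s _ ⟨
  insertAll (b ++ s) (insertAll p t)           ≡⟨ insertAll-++ p (b ++ s) t ⟨
  insertAll (p ++ b ++ s) t                    ∎
  where
  open ≡-Reasoning
insertAll-respects-≡K K-refl        _       t = refl
insertAll-respects-≡K (K-sym e)     letters t = sym (insertAll-respects-≡K e (All-resp-≡K (K-sym e) letters) t)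
insertAll-respects-≡K (K-trans e f) letters t =
  trans (insertAll-respects-≡K e letters t) (insertAll-respects-≡K f (All-resp-≡K e letters) t)

replicate-++-∷ : ∀ n (x : ℕ) ys → replicate n x ++ x ∷ ys ≡ x ∷ replicate n x ++ ys
replicate-++-∷ zero    x ys = refl
replicate-++-∷ (suc n) x ys = cong (x ∷_) (replicate-++-∷ n x ys)

replicate-∷ʳ : ∀ n (x : ℕ) → replicate n x ∷ʳ x ≡ x ∷ replicate n x
replicate-∷ʳ zero    x = refl
replicate-∷ʳ (suc n) x = cong (x ∷_) (replicate-∷ʳ n x)

1<2 : 1 < 2
1<2 = s≤s (s≤s z≤n)

slide-1-past-2s : ∀ k → ((2 ∷ 2^ k) ∷ʳ 1) ≡K (2 ∷ 1 ∷ 2^ k)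
slide-1-past-2s zero    = K-refl
slide-1-past-2s (suc k) = K-trans (≡K-++ˡ (2 ∷ []) (slide-1-past-2s k)) (step [] (2^ k) (knuth1 1<2 ≤-refl))

slide-21-past-1s : ∀ k → (1^ k ++ 2 ∷ 1 ∷ []) ≡K (2 ∷ 1 ∷ 1^ k)
slide-21-past-1s zero    = K-refl
slide-21-past-1s (suc k) = K-trans (≡K-++ˡ (1 ∷ []) (slide-21-past-1s k)) (step [] (1^ k) (knuth2 ≤-refl 1<2))

readingWord-insert : ∀ {x} t → Letter x → (readingWord t ∷ʳ x) ≡K readingWord (insert x t)
readingWord-insert (tab a b c) two = begin
  (2^ c ++ 1^ a ++ 2^ b) ∷ʳ 2      ≡⟨ ++-assoc (2^ c) _ _ ⟩
  2^ c ++ (1^ a ++ 2^ b) ∷ʳ 2      ≡⟨ cong (2^ c ++_) (++-assoc (1^ a) (2^ b) _) ⟩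
  2^ c ++ 1^ a ++ 2^ b ∷ʳ 2        ≡⟨ cong (λ y → 2^ c ++ 1^ a ++ y) (replicate-∷ʳ b 2) ⟩
  2^ c ++ 1^ a ++ 2 ∷ 2^ b         ∎
  where open ≡K-Reasoning
readingWord-insert (tab a zero c) one = begin
  (2^ c ++ 1^ a ++ []) ∷ʳ 1        ≡⟨ ++-assoc (2^ c) _ _ ⟩
  2^ c ++ (1^ a ++ []) ∷ʳ 1        ≡⟨ cong (λ y → 2^ c ++ y ∷ʳ 1) (++-identityʳ (1^ a)) ⟩
  2^ c ++ 1^ a ∷ʳ 1                ≡⟨ cong (2^ c ++_) (replicate-∷ʳ a 1) ⟩
  2^ c ++ 1 ∷ 1^ a                 ≡⟨ cong (λ y → 2^ c ++ 1 ∷ y) (++-identityʳ (1^ a)) ⟨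
  2^ c ++ 1^ (suc a) ++ []         ∎
  where open ≡K-Reasoning
readingWord-insert (tab a (suc b) c) one = begin
  (2^ c ++ 1^ a ++ 2 ∷ 2^ b) ∷ʳ 1        ≡⟨ ++-assoc (2^ c) _ _ ⟩
  2^ c ++ (1^ a ++ 2 ∷ 2^ b) ∷ʳ 1        ≡⟨ cong (2^ c ++_) (++-assoc (1^ a) _ _) ⟩
  2^ c ++ 1^ a ++ (2 ∷ 2^ b) ∷ʳ 1        ≈⟨ ≡K-++ˡ (2^ c) (≡K-++ˡ (1^ a) (slide-1-past-2s b)) ⟩
  2^ c ++ 1^ a ++ 2 ∷ 1 ∷ 2^ b           ≡⟨ cong (2^ c ++_) (++-assoc (1^ a) (2 ∷ 1 ∷ []) (2^ b)) ⟨
  2^ c ++ (1^ a ++ 2 ∷ 1 ∷ []) ++ 2^ b   ≈⟨ ≡K-cong (2^ c) (2^ b) (slide-21-past-1s a) ⟩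
  2^ c ++ (2 ∷ 1 ∷ 1^ a) ++ 2^ b         ≡⟨ replicate-++-∷ c 2 _ ⟩
  2^ (suc c) ++ 1^ (suc a) ++ 2^ b       ∎
  where open ≡K-Reasoning

readingWord-insertAll : ∀ {w} t → All Letter w → (readingWord t ++ w) ≡K readingWord (insertAll w t)
readingWord-insertAll {[]}    t []        = ≡⇒≡K (++-identityʳ _)
readingWord-insertAll {x ∷ w} t (lx ∷ lw) = begin
  readingWord t ++ x ∷ w            ≡⟨ ++-assoc (readingWord t) (x ∷ []) w ⟨
  (readingWord t ∷ʳ x) ++ w         ≈⟨ ≡K-++ʳ w (readingWord-insert t lx) ⟩
  readingWord (insert x t) ++ w     ≈⟨ readingWord-insertAll (insert x t) lw ⟩
  readingWord (insertAll w (insert x t)) ∎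
  where open ≡K-Reasoning

≡K-readingWord-P : ∀ {w} → All Letter w → w ≡K readingWord (P w)
≡K-readingWord-P = readingWord-insertAll ∅

≡K⇔P≡ : ∀ {u v} → All Letter u → All Letter v → u ≡K v ⇔ (P u ≡ P v)
≡K⇔P≡ {u} {v} lu lv = mk⇔ (λ e → insertAll-respects-≡K e lu ∅) same-P⇒≡K
  where
  same-P⇒≡K : P u ≡ P v → u ≡K v
  same-P⇒≡K eq = begin
    u                  ≈⟨ ≡K-readingWord-P lu ⟩
    readingWord (P u)  ≡⟨ cong readingWord eq ⟩
    readingWord (P v)  ≈⟨ ≡K-readingWord-P lv ⟨
    v                  ∎
    where open ≡K-Reasoning

addOne : Tableau → Tableau
addOne (tab a b c) = tab (suc a) b c

insert-addOne : ∀ x t → insert x (addOne t) ≡ addOne (insert x t)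
insert-addOne 0             t                 = refl
insert-addOne 1             (tab a zero c)    = refl
insert-addOne 1             (tab a (suc b) c) = refl
insert-addOne (suc (suc _)) t                 = refl

insertAll-addOne : ∀ w t → insertAll w (addOne t) ≡ addOne (insertAll w t)
insertAll-addOne []      t = refl
insertAll-addOne (x ∷ w) t = trans (cong (insertAll w) (insert-addOne x t)) (insertAll-addOne w (insert x t))

P-∷ʳ : ∀ w x → P (w ∷ʳ x) ≡ insert x (P w)
P-∷ʳ w x = insertAll-++ w (x ∷ []) ∅

addOne≡insert1⇔ : ∀ t → (addOne t ≡ insert 1 t) ⇔ (twos₁ t ≡ 0)
addOne≡insert1⇔ (tab a zero c)    = mk⇔ (λ _ → refl) (λ _ → refl)
addOne≡insert1⇔ (tab a (suc b) c) = mk⇔ (λ ()) (λ ())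

commutes-one⇔ : ∀ {w} → All Letter w → Commutes (1 ∷ []) w ⇔ (twos₁ (P w) ≡ 0)
commutes-one⇔ {w} lw = begin
  Commutes (1 ∷ []) w              ≈⟨ ≡K⇔P≡ (one ∷ lw) (All.++⁺ lw (one ∷ [])) ⟩
  (P (1 ∷ w) ≡ P (w ∷ʳ 1))         ≡⟨ cong₂ _≡_ (insertAll-addOne w ∅) (P-∷ʳ w 1) ⟩
  (addOne (P w) ≡ insert 1 (P w))  ≈⟨ addOne≡insert1⇔ (P w) ⟩
  (twos₁ (P w) ≡ 0)                ∎
  where open SetoidReasoning (⇔-setoid 0ℓ)

twoFreeWords : ℕ → Tableau → List Word
twoFreeWords zero    (tab _ zero    _) = [] ∷ []
twoFreeWords zero    (tab _ (suc _) _) = []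
twoFreeWords (suc n) t = map (1 ∷_) (twoFreeWords n (insert 1 t)) ++ map (2 ∷_) (twoFreeWords n (insert 2 t))

twoFreeWords-sound : ∀ n t {w} → w ∈ twoFreeWords n t →
                     length w ≡ n × All Letter w × twos₁ (insertAll w t) ≡ 0
twoFreeWords-sound zero    (tab _ zero _) (here refl) = refl , [] , refl
twoFreeWords-sound (suc n) t w∈ with ∈-++⁻ (map (1 ∷_) (twoFreeWords n (insert 1 t))) w∈
... | inj₁ w∈₁ with ∈-map⁻ (1 ∷_) w∈₁
...   | v , v∈ , refl with twoFreeWords-sound n (insert 1 t) v∈
...     | lv , letters , noTwos = cong suc lv , one ∷ letters , noTwos
twoFreeWords-sound (suc n) t w∈ | inj₂ w∈₂ with ∈-map⁻ (2 ∷_) w∈₂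
...   | v , v∈ , refl with twoFreeWords-sound n (insert 2 t) v∈
...     | lv , letters , noTwos = cong suc lv , two ∷ letters , noTwos

twoFreeWords-complete : ∀ {w} t → All Letter w → twos₁ (insertAll w t) ≡ 0 → w ∈ twoFreeWords (length w) t
twoFreeWords-complete         (tab _ _ _) []          refl   = here refl
twoFreeWords-complete {1 ∷ w} t           (one ∷ lw) noTwos =
  ∈-++⁺ˡ (∈-map⁺ (1 ∷_) (twoFreeWords-complete (insert 1 t) lw noTwos))
twoFreeWords-complete {2 ∷ w} t           (two ∷ lw) noTwos =
  ∈-++⁺ʳ (map (1 ∷_) (twoFreeWords (length w) (insert 1 t))) (∈-map⁺ (2 ∷_) (twoFreeWords-complete (insert 2 t) lw noTwos))

twoFreeWords-unique : ∀ n t → Unique (twoFreeWords n t)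
twoFreeWords-unique zero    (tab _ zero    _) = [] AllPairs.∷ AllPairs.[]
twoFreeWords-unique zero    (tab _ (suc _) _) = AllPairs.[]
twoFreeWords-unique (suc n) t =
  Unique.++⁺ (Unique.map⁺ ∷-injectiveʳ (twoFreeWords-unique n (insert 1 t)))
             (Unique.map⁺ ∷-injectiveʳ (twoFreeWords-unique n (insert 2 t)))
             first-letters-differ
  where
  first-letters-differ : ∀ {w} → w ∈ map (1 ∷_) (twoFreeWords n (insert 1 t)) × w ∈ map (2 ∷_) (twoFreeWords n (insert 2 t)) → ⊥
  first-letters-differ (w∈₁ , w∈₂) with ∈-map⁻ (1 ∷_) w∈₁ | ∈-map⁻ (2 ∷_) w∈₂
  ... | _ , _ , refl | _ , _ , ()

nC⌈n/2⌉≡nC⌊n/2⌋ : ∀ n → n C ⌈ n /2⌉ ≡ n C ⌊ n /2⌋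
nC⌈n/2⌉≡nC⌊n/2⌋ n = trans (nCk≡nC[n∸k] (⌈n/2⌉≤n n)) (cong (n C_) n∸⌈n/2⌉≡⌊n/2⌋)
  where
  n∸⌈n/2⌉≡⌊n/2⌋ : n ∸ ⌈ n /2⌉ ≡ ⌊ n /2⌋
  n∸⌈n/2⌉≡⌊n/2⌋ = trans (cong (_∸ ⌈ n /2⌉) (sym (⌊n/2⌋+⌈n/2⌉≡n n))) (m+n∸n≡m ⌊ n /2⌋ ⌈ n /2⌉)

⌊n/2⌋≡n/2 : ∀ n → ⌊ n /2⌋ ≡ n / 2
⌊n/2⌋≡n/2 zero          = refl
⌊n/2⌋≡n/2 (suc zero)    = refl
⌊n/2⌋≡n/2 (suc (suc n)) = trans (cong suc (⌊n/2⌋≡n/2 n)) (sym (m/n≡1+[m∸n]/n {suc (suc n)} {2} (s≤s (s≤s z≤n))))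

length-twoFreeWords : ∀ n t → length (twoFreeWords n t) ≡ n C ⌈ (twos₁ t + n) /2⌉
length-twoFreeWords zero    (tab _ zero    _) = refl
length-twoFreeWords zero    (tab _ (suc _) _) = refl
length-twoFreeWords (suc n) t = trans split (count t)
  where
  open ≡-Reasoning
  split : length (twoFreeWords (suc n) t) ≡ length (twoFreeWords n (insert 1 t)) + length (twoFreeWords n (insert 2 t))
  split = trans (length-++ (map (1 ∷_) (twoFreeWords n (insert 1 t))))
                (cong₂ _+_ (length-map (1 ∷_) (twoFreeWords n (insert 1 t))) (length-map (2 ∷_) (twoFreeWords n (insert 2 t))))
  count : ∀ t → length (twoFreeWords n (insert 1 t)) + length (twoFreeWords n (insert 2 t)) ≡ suc n C ⌈ (twos₁ t + suc n) /2⌉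
  count (tab a zero c) = begin
    length (twoFreeWords n (tab (suc a) 0 c)) + length (twoFreeWords n (tab a 1 c))
      ≡⟨ cong₂ _+_ (length-twoFreeWords n (tab (suc a) 0 c)) (length-twoFreeWords n (tab a 1 c)) ⟩
    n C ⌈ n /2⌉ + n C suc ⌊ n /2⌋  ≡⟨ cong (_+ n C suc ⌊ n /2⌋) (nC⌈n/2⌉≡nC⌊n/2⌋ n) ⟩
    n C ⌊ n /2⌋ + n C suc ⌊ n /2⌋  ≡⟨ nCk+nC[k+1]≡[n+1]C[k+1] n ⌊ n /2⌋ ⟩
    suc n C suc ⌊ n /2⌋            ∎
  count (tab a (suc b) c) = begin
    length (twoFreeWords n (tab (suc a) b (suc c))) + length (twoFreeWords n (tab a (suc (suc b)) c))
      ≡⟨ cong₂ _+_ (length-twoFreeWords n (tab (suc a) b (suc c))) (length-twoFreeWords n (tab a (suc (suc b)) c)) ⟩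
    n C ⌈ (b + n) /2⌉ + n C suc ⌈ (b + n) /2⌉  ≡⟨ nCk+nC[k+1]≡[n+1]C[k+1] n ⌈ (b + n) /2⌉ ⟩
    suc n C suc ⌈ (b + n) /2⌉                  ≡⟨ cong (λ m → suc n C ⌈ suc m /2⌉) (+-suc b n) ⟨
    suc n C ⌈ (suc b + suc n) /2⌉              ∎

c-is-one : ∀ n → c-is n 2 (1 ∷ []) (n C ⌈ n /2⌉)
c-is-one n = twoFreeWords n ∅ , twoFreeWords-unique n ∅ , membership , length-twoFreeWords n ∅
  where
  membership : ∀ w → (w ∈ twoFreeWords n ∅) ⇔ (InAlphabet n 2 w × Commutes (1 ∷ []) w)
  membership w = mk⇔ sound complete
    where
    sound : w ∈ twoFreeWords n ∅ → InAlphabet n 2 w × Commutes (1 ∷ []) w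
    sound w∈ with twoFreeWords-sound n ∅ w∈
    ... | lw , letters , noTwos = Equivalence.from inAlphabet₂⇔ (lw , letters) , Equivalence.from (commutes-one⇔ letters) noTwos
    complete : InAlphabet n 2 w × Commutes (1 ∷ []) w → w ∈ twoFreeWords n ∅
    complete (inA , c) with Equivalence.to inAlphabet₂⇔ inA
    ... | refl , letters = twoFreeWords-complete ∅ letters (Equivalence.to (commutes-one⇔ letters) c)

flip₁₂ : ℕ → ℕ
flip₁₂ 1 = 2
flip₁₂ 2 = 1
flip₁₂ a = a

flip₁₂-involutive : ∀ a → flip₁₂ (flip₁₂ a) ≡ a
flip₁₂-involutive 0                   = refl
flip₁₂-involutive 1                   = refl
flip₁₂-involutive 2                   = refl
flip₁₂-involutive (suc (suc (suc _))) = refl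

flip₁₂-letter : ∀ {a} → Letter a → Letter (flip₁₂ a)
flip₁₂-letter one = two
flip₁₂-letter two = one

reverseComplement : Word → Word
reverseComplement w = reverse (map flip₁₂ w)

reverseComplement-involutive : ∀ w → reverseComplement (reverseComplement w) ≡ w
reverseComplement-involutive w = begin
  reverse (map flip₁₂ (reverse (map flip₁₂ w)))  ≡⟨ cong reverse (reverse-map flip₁₂ (map flip₁₂ w)) ⟩
  reverse (reverse (map flip₁₂ (map flip₁₂ w)))  ≡⟨ reverse-involutive _ ⟩
  map flip₁₂ (map flip₁₂ w)                      ≡⟨ map-∘ w ⟨
  map (λ a → flip₁₂ (flip₁₂ a)) w                ≡⟨ map-cong flip₁₂-involutive w ⟩
  map id w                                       ≡⟨ map-id w ⟩
  w                                              ∎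
  where open ≡-Reasoning

reverseComplement-injective : ∀ {u v} → reverseComplement u ≡ reverseComplement v → u ≡ v
reverseComplement-injective {u} {v} eq =
  trans (sym (reverseComplement-involutive u)) (trans (cong reverseComplement eq) (reverseComplement-involutive v))

reverseComplement-++ : ∀ u v → reverseComplement (u ++ v) ≡ reverseComplement v ++ reverseComplement u
reverseComplement-++ u v = trans (cong reverse (map-++ flip₁₂ u v)) (reverse-++ (map flip₁₂ u) (map flip₁₂ v))

reverseComplement-respects-knuthStep₁₂ : ∀ {u v} → KnuthStep₁₂ u v → reverseComplement u ≡K reverseComplement v
reverseComplement-respects-knuthStep₁₂ 221~212 = K-sym (knuthStep⇒≡K (knuth2 ≤-refl 1<2))
reverseComplement-respects-knuthStep₁₂ 121~211 = K-sym (knuthStep⇒≡K (knuth1 1<2 ≤-refl))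

reverseComplement-respects-≡K : ∀ {u v} → u ≡K v → All Letter u → reverseComplement u ≡K reverseComplement v
reverseComplement-respects-≡K (step p s {a} {b} k) letters = begin
  rc (p ++ a ++ s)       ≡⟨ rc-++-++ a ⟩
  rc s ++ rc a ++ rc p   ≈⟨ ≡K-cong (rc s) (rc p) (reverseComplement-respects-knuthStep₁₂ (knuthStep₁₂ k (All-++-middle p letters))) ⟩
  rc s ++ rc b ++ rc p   ≡⟨ rc-++-++ b ⟨
  rc (p ++ b ++ s)       ∎
  where
  open ≡K-Reasoning
  rc : Word → Word
  rc = reverseComplement
  rc-++-++ : ∀ x → rc (p ++ x ++ s) ≡ rc s ++ rc x ++ rc p
  rc-++-++ x = trans (reverseComplement-++ p (x ++ s))
                     (trans (cong (_++ rc p) (reverseComplement-++ x s)) (++-assoc (rc s) (rc x) (rc p)))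
reverseComplement-respects-≡K K-refl        _       = K-refl
reverseComplement-respects-≡K (K-sym e)     letters = K-sym (reverseComplement-respects-≡K e (All-resp-≡K (K-sym e) letters))
reverseComplement-respects-≡K (K-trans e f) letters =
  K-trans (reverseComplement-respects-≡K e letters) (reverseComplement-respects-≡K f (All-resp-≡K e letters))

All-Letter-reverseComplement : ∀ {w} → All Letter w → All Letter (reverseComplement w)
All-Letter-reverseComplement {w} lw = All-resp-↭ (↭-sym (↭-reverse (map flip₁₂ w))) (All.map⁺ (All.map flip₁₂-letter lw))

inAlphabet₂-reverseComplement : ∀ {n w} → InAlphabet n 2 w → InAlphabet n 2 (reverseComplement w)
inAlphabet₂-reverseComplement {n} {w} inA with Equivalence.to inAlphabet₂⇔ inA
... | refl , lw = Equivalence.from inAlphabet₂⇔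
  (trans (length-reverse (map flip₁₂ w)) (length-map flip₁₂ w) , All-Letter-reverseComplement lw)

commutes-reverseComplement : ∀ {u w} → All Letter u → All Letter w →
                             Commutes u w → Commutes (reverseComplement u) (reverseComplement w)
commutes-reverseComplement {u} {w} lu lw c = begin
  rc u ++ rc w   ≡⟨ reverseComplement-++ w u ⟨
  rc (w ++ u)    ≈⟨ reverseComplement-respects-≡K (K-sym c) (All.++⁺ lw lu) ⟩
  rc (u ++ w)    ≡⟨ reverseComplement-++ u w ⟩
  rc w ++ rc u   ∎
  where
  open ≡K-Reasoning
  rc : Word → Word
  rc = reverseComplement

∈-map-involutive : ∀ {A : Set} {f : A → A} → (∀ x → f (f x) ≡ x) → ∀ {x xs} → x ∈ map f xs ⇔ f x ∈ xs
∈-map-involutive {f = f} f-involutive {x} = mk⇔ to from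
  where
  to : ∀ {xs} → x ∈ map f xs → f x ∈ xs
  to x∈ with ∈-map⁻ f x∈
  ... | y , y∈ , refl = subst (_∈ _) (sym (f-involutive y)) y∈
  from : ∀ {xs} → f x ∈ xs → x ∈ map f xs
  from fx∈ = subst (_∈ _) (f-involutive x) (∈-map⁺ f fx∈)

commuting-reverseComplement : ∀ {n u w} → All Letter u → InAlphabet n 2 w × Commutes u w →
                              InAlphabet n 2 (reverseComplement w) × Commutes (reverseComplement u) (reverseComplement w)
commuting-reverseComplement lu (inA , c) =
  inAlphabet₂-reverseComplement inA , commutes-reverseComplement lu (proj₂ (Equivalence.to inAlphabet₂⇔ inA)) c

commuting-with-two⇔ : ∀ n w → (InAlphabet n 2 w × Commutes (2 ∷ []) w) ⇔
                              (InAlphabet n 2 (reverseComplement w) × Commutes (1 ∷ []) (reverseComplement w))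
commuting-with-two⇔ n w = mk⇔ (commuting-reverseComplement (two ∷ []))
  (λ p → subst (λ v → InAlphabet n 2 v × Commutes (2 ∷ []) v) (reverseComplement-involutive w)
               (commuting-reverseComplement (one ∷ []) p))

c-is-two : ∀ {n k} → c-is n 2 (1 ∷ []) k → c-is n 2 (2 ∷ []) k
c-is-two {n} (L , unique , membership , length≡k) =
  map reverseComplement L , Unique.map⁺ reverseComplement-injective unique , membership′ , trans (length-map reverseComplement L) length≡k
  where
  membership′ : ∀ w → (w ∈ map reverseComplement L) ⇔ (InAlphabet n 2 w × Commutes (2 ∷ []) w)
  membership′ w = begin
    w ∈ map reverseComplement L                                                       ≈⟨ ∈-map-involutive reverseComplement-involutive ⟩
    reverseComplement w ∈ L                                                           ≈⟨ membership (reverseComplement w) ⟩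
    (InAlphabet n 2 (reverseComplement w) × Commutes (1 ∷ []) (reverseComplement w))  ≈⟨ commuting-with-two⇔ n w ⟨
    (InAlphabet n 2 w × Commutes (2 ∷ []) w)                                          ∎
    where open SetoidReasoning (⇔-setoid 0ℓ)

corollary5p3 : (n : ℕ) →
    c-is n 2 (1 ∷ []) (n C (n / 2)) × c-is n 2 (2 ∷ []) (n C (n / 2))
corollary5p3 n = commuting-with-one , c-is-two commuting-with-one
  where
  middle : n C ⌈ n /2⌉ ≡ n C (n / 2)
  middle = trans (nC⌈n/2⌉≡nC⌊n/2⌋ n) (cong (n C_) (⌊n/2⌋≡n/2 n))
  commuting-with-one : c-is n 2 (1 ∷ []) (n C (n / 2))
  commuting-with-one = subst (c-is n 2 (1 ∷ [])) middle (c-is-one n)
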